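{- For any Kleene algebra $\mathbb{K}$, the structure $\mathbb{K}^+$ is a heterogeneous Kleene algebra; if $\mathbb{K}$ is a continuous Kleene algebra, then $\mathbb{K}^+$ is a continuous heterogeneous Kleene algebra.
   Context: A Kleene algebra is a structure $(K, \cup, \cdot, ()^\ast, 1, 0)$ such that: (K1) $(K,\cup,0)$ is a join-semilattice with bottom $0$; (K2) $(K,\cdot,1)$ is a monoid, $\cdot$ preserves $\cup$ in each coordinate, $0$ annihilates $\cdot$; (K3) $1\cup\alpha\cdot\alpha^\ast\leq\alpha^\ast$, $1\cup\alpha^\ast\cdot\alpha\leq\alpha^\ast$, $1\cup\alpha^\ast\cdot\alpha^\ast\leq\alpha^\ast$; (K4) $\alpha\cdot\beta\leq\beta$ implies $\alpha^\ast\cdot\beta\leq\beta$; (K5) $\beta\cdot\alpha\leq\beta$ implies $\beta\cdot\alpha^\ast\leq\beta$. It is continuous if moreover $(K,\cup,0)$ is a complete join-semilattice, $\cdot$ preserves arbitrary joins in each coordinate, and $\alpha^\ast=\bigcup_{n\geq 0}\alpha^n$ ($\alpha^0=1$, $\alpha^{n+1}=\alpha^n\cdot\alpha$). A heterogeneous Kleene algebra is a tuple $\mathbb{H}=(\mathbb{A},\mathbb{s},\otimes_1,\otimes_2,\gamma,e)$ such that: (H1) $\mathbb{A}=(A,\sqcup,\cdot,1,0)$ where $(A,\sqcup,0)$ is a join-semilattice with bottom $0$, $(A,\cdot,1)$ is a monoid, $\cdot$ preserves finite joins in each coordinate and $0$ annihilates $\cdot$; (H2) $\mathbb{s}=(S,\sqcup,0_s)$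 is a join-semilattice with bottom $0_s$; (H3) $\otimes_1:S\times A\to A$ preserves finite joins in its second coordinate, is monotone in its first coordinate and has unit $1$ in its second coordinate, and $\otimes_2:A\times S\to A$ preserves finite joins in its first coordinate, is monotone in its second coordinate and has unit $1$ in its first coordinate; moreover $\xi\otimes_1\alpha=e(\xi)\cdot\alpha$ and $\alpha\otimes_2\xi=\alpha\cdot e(\xi)$ for all $\alpha\in A,\xi\in S$; (H4) $\gamma:A\to S$ (surjective) and $e:S\to A$ (injective) satisfy $\gamma\dashv e$ (i.e. $\gamma(\alpha)\leq\xi$ iff $\alpha\leq e(\xi)$) and $\gamma(e(\xi))=\xi$ for all $\xi\in S$; (H5) $1\leq e(\xi)$ and $e(\xi)\cdot e(\xi)\leq e(\xi)$ for all $\xi\in S$; (H6) for all $\alpha,\beta\in A$, $\alpha\cdot\beta\leq\beta$ implies $\gamma(\alpha)\otimes_1\beta\leq\beta$, and $\beta\cdot\alpha\leq\beta$ implies $\beta\otimes_2\gamma(\alpha)\leq\beta$. It is continuous if moreover (H1') $(A,\sqcup,0)$ is complete and $\cdot$ preserves arbitrary joins in each coordinate; (H2') $\mathbb{s}$ is a complete join-semilattice; (H7) $e(\gamma(\alpha))=\bigcup_{n\in\mathbb{N}}\alpha^n$ for all $\alpha$. For a Kleene algebra $\mathbb{K}=(K,\cup,\cdot,()^\ast,1,0)$, $\mathbb{K}^+=(\mathbb{A},\mathbb{s},\otimes_1,\otimes_2,\gamma,e)$ is defined by: $\mathbb{A}=(K,\cup,\cdot,1,0)$; $\mathbb{s}=(S,\sqcup,0_s)$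 is the kernel of $\mathbb{K}$, i.e. $S=\mathsf{Range}(()^\ast)$ with $\xi\sqcup\chi:=(\xi\cup\chi)^\ast$ and $0_s:=0^\ast$; $\gamma(\alpha)=\alpha^\ast$ and $e:S\hookrightarrow K$ is the inclusion; $\xi\otimes_1\alpha=\xi\cdot\alpha$ and $\alpha\otimes_2\xi=\alpha\cdot\xi$ for $\xi\in S,\alpha\in K$. -}

module Defs where

open import Level using (Level; _⊔_; suc)
open import Data.Nat using (ℕ; zero) renaming (suc to sucℕ)
open import Data.Product using (Σ; Σ-syntax; ∃; ∃-syntax; _×_; _,_; proj₁)
open import Relation.Unary using (Pred)
open import Relation.Binary.Core using (Rel)
open import Algebra.Core using (Op₁; Op₂)
open import Algebra.Structures using (IsIdempotentSemiring; IsIdempotentCommutativeMonoid)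

module Order {a ℓ : Level} {A : Set a} (_≈_ : Rel A ℓ) (_∨_ : Op₂ A) where

  infix 4 _≤_
  _≤_ : Rel A ℓ
  x ≤ y = (x ∨ y) ≈ y

  IsLub : {p : Level} → Pred A p → A → Set (a ⊔ ℓ ⊔ p)
  IsLub P s = (∀ x → P x → x ≤ s) × (∀ u → (∀ x → P x → x ≤ u) → s ≤ u)

  Complete : (p : Level) → Set (suc (a ⊔ ℓ ⊔ p))
  Complete p = (P : Pred A (a ⊔ ℓ ⊔ p)) → Σ[ s ∈ A ] IsLub P s

  PreservesJoins : (p : Level) → Op₁ A → Set (suc (a ⊔ ℓ ⊔ p))
  PreservesJoins p f = (P : Pred A (a ⊔ ℓ ⊔ p)) (s : A) → IsLub P s →
                       IsLub (λ y → ∃[ x ] (P x × (y ≈ f x))) (f s)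

  RangeSeq : (ℕ → A) → Pred A ℓ
  RangeSeq f y = ∃[ n ] (y ≈ f n)

pow : {a : Level} {A : Set a} → Op₂ A → A → A → ℕ → A
pow _·_ 1# α zero     = 1#
pow _·_ 1# α (sucℕ n) = pow _·_ 1# α n · α

record KleeneAlgebra (c ℓ : Level) : Set (suc (c ⊔ ℓ)) where
  infixl 7 _·_
  infixl 6 _∪_
  infix  4 _≈_
  field
    Carrier : Set c
    _≈_     : Rel Carrier ℓ
    _∪_     : Op₂ Carrier
    _·_     : Op₂ Carrier
    _⋆      : Op₁ Carrier
    1#      : Carrier
    0#      : Carrier
    isIdempotentSemiring : IsIdempotentSemiring _≈_ _∪_ _·_ 0# 1#

  open Order _≈_ _∪_ public

  field
    star-unfoldˡ : ∀ α → (1# ∪ α · (α ⋆)) ≤ (α ⋆)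
    star-unfoldʳ : ∀ α → (1# ∪ (α ⋆) · α) ≤ (α ⋆)
    star-trans   : ∀ α → (1# ∪ (α ⋆) · (α ⋆)) ≤ (α ⋆)
    star-indˡ    : ∀ α β → α · β ≤ β → (α ⋆) · β ≤ β
    star-indʳ    : ∀ α β → β · α ≤ β → β · (α ⋆) ≤ β

record IsContinuousKA {c ℓ : Level} (p : Level) (K : KleeneAlgebra c ℓ)
       : Set (suc (c ⊔ ℓ ⊔ p)) where
  open KleeneAlgebra K
  field
    complete   : Complete p
    ·-joinsˡ   : ∀ α → PreservesJoins p (α ·_)
    ·-joinsʳ   : ∀ α → PreservesJoins p (_· α)
    star-lub   : ∀ α → IsLub (RangeSeq (pow _·_ 1# α)) (α ⋆)

record HKAData (a ℓa s ℓs : Level) : Set (suc (a ⊔ ℓa ⊔ s ⊔ ℓs)) where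
  field
    A     : Set a
    _≈_   : Rel A ℓa
    _⊔ₐ_  : Op₂ A
    _·_   : Op₂ A
    1#    : A
    0#    : A
    S     : Set s
    _≈ₛ_  : Rel S ℓs
    _⊔ₛ_  : Op₂ S
    0ₛ    : S
    _⊗₁_  : S → A → A
    _⊗₂_  : A → S → A
    γ     : A → S
    e     : S → A

record IsHKA {a ℓa s ℓs : Level} (H : HKAData a ℓa s ℓs) : Set (a ⊔ ℓa ⊔ s ⊔ ℓs) where
  open HKAData H
  open Order _≈_ _⊔ₐ_ using (_≤_)
  open Order _≈ₛ_ _⊔ₛ_ using () renaming (_≤_ to _≤ₛ_)
  field
    isIdempotentSemiring : IsIdempotentSemiring _≈_ _⊔ₐ_ _·_ 0# 1#
    isSemilatticeₛ : IsIdempotentCommutativeMonoid _≈ₛ_ _⊔ₛ_ 0ₛ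
    ⊗₁-join   : ∀ ξ α β → (ξ ⊗₁ (α ⊔ₐ β)) ≈ ((ξ ⊗₁ α) ⊔ₐ (ξ ⊗₁ β))
    ⊗₁-zero   : ∀ ξ → (ξ ⊗₁ 0#) ≈ 0#
    ⊗₁-mono   : ∀ ξ χ α → ξ ≤ₛ χ → (ξ ⊗₁ α) ≤ (χ ⊗₁ α)
    ⊗₁-unit   : ∀ ξ → (ξ ⊗₁ 1#) ≈ e ξ
    ⊗₂-join   : ∀ α β ξ → ((α ⊔ₐ β) ⊗₂ ξ) ≈ ((α ⊗₂ ξ) ⊔ₐ (β ⊗₂ ξ))
    ⊗₂-zero   : ∀ ξ → (0# ⊗₂ ξ) ≈ 0#
    ⊗₂-mono   : ∀ α ξ χ → ξ ≤ₛ χ → (α ⊗₂ ξ) ≤ (α ⊗₂ χ)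
    ⊗₂-unit   : ∀ ξ → (1# ⊗₂ ξ) ≈ e ξ
    ⊗₁-e      : ∀ ξ α → (ξ ⊗₁ α) ≈ (e ξ · α)
    ⊗₂-e      : ∀ α ξ → (α ⊗₂ ξ) ≈ (α · e ξ)
    γ-surjective : ∀ ξ → ∃[ α ] (γ α ≈ₛ ξ)
    e-injective  : ∀ ξ χ → e ξ ≈ e χ → ξ ≈ₛ χ
    adjunction₁  : ∀ α ξ → γ α ≤ₛ ξ → α ≤ e ξ
    adjunction₂  : ∀ α ξ → α ≤ e ξ → γ α ≤ₛ ξ
    γ∘e          : ∀ ξ → γ (e ξ) ≈ₛ ξ
    e-refl       : ∀ ξ → 1# ≤ e ξ
    e-trans      : ∀ ξ → (e ξ · e ξ) ≤ e ξ
    H6ˡ          : ∀ α β → (α · β) ≤ β → (γ α ⊗₁ β) ≤ β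
    H6ʳ          : ∀ α β → (β · α) ≤ β → (β ⊗₂ γ α) ≤ β

record IsContinuousHKA {a ℓa s ℓs : Level} (p : Level) (H : HKAData a ℓa s ℓs)
       : Set (suc (a ⊔ ℓa ⊔ s ⊔ ℓs ⊔ p)) where
  open HKAData H
  open Order _≈_ _⊔ₐ_
  open Order _≈ₛ_ _⊔ₛ_ using () renaming (Complete to Completeₛ)
  field
    isHKA     : IsHKA H
    completeₐ : Complete p
    ·-joinsˡ  : ∀ α → PreservesJoins p (α ·_)
    ·-joinsʳ  : ∀ α → PreservesJoins p (_· α)
    completeₛ : Completeₛ p
    H7        : ∀ α → IsLub (RangeSeq (pow _·_ 1# α)) (e (γ α))

Kernel : {c ℓ : Level} → KleeneAlgebra c ℓ → Set (c ⊔ ℓ)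
Kernel K = Σ[ x ∈ Carrier ] ∃[ α ] (x ≈ (α ⋆))
  where open KleeneAlgebra K

_⁺ : {c ℓ : Level} (K : KleeneAlgebra c ℓ) → HKAData c ℓ (c ⊔ ℓ) ℓ
_⁺ {c} {ℓ} K = record
  { A     = Carrier
  ; _≈_   = _≈_
  ; _⊔ₐ_  = _∪_
  ; _·_   = _·_
  ; 1#    = 1#
  ; 0#    = 0#
  ; S     = Kernel K
  ; _≈ₛ_  = λ ξ χ → proj₁ ξ ≈ proj₁ χ
  ; _⊔ₛ_  = λ ξ χ → ((proj₁ ξ ∪ proj₁ χ) ⋆) , ((proj₁ ξ ∪ proj₁ χ) , refl)
  ; 0ₛ    = (0# ⋆) , (0# , refl)
  ; _⊗₁_  = λ ξ α → proj₁ ξ · α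
  ; _⊗₂_  = λ α ξ → α · proj₁ ξ
  ; γ     = λ α → (α ⋆) , (α , refl)
  ; e     = proj₁
  }
  where
  open KleeneAlgebra K
  open IsIdempotentSemiring isIdempotentSemiring using (refl)

-- The kernel S = { α⋆ } of a Kleene algebra is the set of fixed points of
-- the closure operator ()⋆, so it is a join-semilattice under ξ ⊔ χ = (ξ ∪ χ)⋆
-- whose order is the restriction of the order of K, and ()⋆ : K → S is left
-- adjoint to the inclusion.  The remaining axioms of 𝕂⁺ are the semiring laws
-- and (K3)-(K5) read off for kernel elements; in the continuous case the join
-- of a family in S is the star of its join in K.
module Submission where

open import Defs
open import Level using (Level; _⊔_)
open import Data.Product using (_×_; _,_; proj₁; proj₂; ∃)
open import Relation.Unary using (Pred)
open import Relation.Binary.Core using (Rel)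
open import Relation.Binary.Bundles using (Poset)
open import Algebra.Core using (Op₂)
open import Algebra.Structures
  using (IsIdempotentSemiring; IsIdempotentCommutativeMonoid)
import Relation.Binary.Reasoning.Setoid as ≈-Reasoning
import Relation.Binary.Reasoning.PartialOrder as ≤-Reasoning

module IdempotentSemiringOrder
  {c ℓ} {A : Set c} {_≈_ : Rel A ℓ} {_+_ _*_ : Op₂ A} {0# 1# : A}
  (isIdempotentSemiring : IsIdempotentSemiring _≈_ _+_ _*_ 0# 1#) where

  open IsIdempotentSemiring isIdempotentSemiring
  open Order _≈_ _+_ using (_≤_)

  ≤-reflexive : ∀ {x y} → x ≈ y → x ≤ y
  ≤-reflexive {y = y} x≈y = trans (+-congʳ x≈y) (+-idem y)

  ≤-refl : ∀ {x} → x ≤ x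
  ≤-refl = ≤-reflexive refl

  ≤-trans : ∀ {x y z} → x ≤ y → y ≤ z → x ≤ z
  ≤-trans {x} {y} {z} x≤y y≤z = begin
    x + z        ≈⟨ +-congˡ y≤z ⟨
    x + (y + z)  ≈⟨ +-assoc x y z ⟨
    (x + y) + z  ≈⟨ +-congʳ x≤y ⟩
    y + z        ≈⟨ y≤z ⟩
    z            ∎
    where open ≈-Reasoning setoid

  ≤-antisym : ∀ {x y} → x ≤ y → y ≤ x → x ≈ y
  ≤-antisym {x} {y} x≤y y≤x = trans (sym y≤x) (trans (+-comm y x) x≤y)

  ≤-resp-≈ : ∀ {x x′ y y′} → x ≈ x′ → y ≈ y′ → x ≤ y → x′ ≤ y′
  ≤-resp-≈ x≈x′ y≈y′ x≤y = trans (+-cong (sym x≈x′) (sym y≈y′)) (trans x≤y y≈y′)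

  x≤x+y : ∀ {x y} → x ≤ x + y
  x≤x+y {x} {y} = trans (sym (+-assoc x x y)) (+-congʳ (+-idem x))

  y≤x+y : ∀ {x y} → y ≤ x + y
  y≤x+y {x} {y} = ≤-resp-≈ refl (+-comm y x) x≤x+y

  +-least : ∀ {x y z} → x ≤ z → y ≤ z → x + y ≤ z
  +-least {x} {y} {z} x≤z y≤z = trans (+-assoc x y z) (trans (+-congˡ y≤z) x≤z)

  +-mono-≤ : ∀ {x x′ y y′} → x ≤ x′ → y ≤ y′ → x + y ≤ x′ + y′
  +-mono-≤ x≤x′ y≤y′ = +-least (≤-trans x≤x′ x≤x+y) (≤-trans y≤y′ y≤x+y)

  *-monoˡ-≤ : ∀ {x y} z → x ≤ y → x * z ≤ y * z
  *-monoˡ-≤ {x} {y} z x≤y = trans (sym (distribʳ z x y)) (*-congʳ x≤y)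

  *-monoʳ-≤ : ∀ {x y} z → x ≤ y → z * x ≤ z * y
  *-monoʳ-≤ {x} {y} z x≤y = trans (sym (distribˡ z x y)) (*-congˡ x≤y)

  poset : Poset c ℓ ℓ
  poset = record
    { isPartialOrder = record
      { isPreorder = record
        { isEquivalence = isEquivalence
        ; reflexive     = ≤-reflexive
        ; trans         = ≤-trans
        }
      ; antisym = ≤-antisym
      }
    }

module KleeneAlgebraProperties {c ℓ} (K : KleeneAlgebra c ℓ) where

  open KleeneAlgebra K
  open IsIdempotentSemiring isIdempotentSemiring
  open IdempotentSemiringOrder isIdempotentSemiring public
  open ≤-Reasoning poset

  1≤x⋆ : ∀ x → 1# ≤ x ⋆
  1≤x⋆ x = ≤-trans x≤x+y (star-unfoldˡ x)

  x⋆x⋆≤x⋆ : ∀ x → x ⋆ · x ⋆ ≤ x ⋆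
  x⋆x⋆≤x⋆ x = ≤-trans y≤x+y (star-trans x)

  x≤x·y⋆ : ∀ x y → x ≤ x · y ⋆
  x≤x·y⋆ x y = begin
    x       ≈⟨ *-identityʳ x ⟨
    x · 1#  ≤⟨ *-monoʳ-≤ x (1≤x⋆ y) ⟩
    x · y ⋆ ∎

  x≤x⋆ : ∀ x → x ≤ x ⋆
  x≤x⋆ x = begin
    x             ≤⟨ x≤x·y⋆ x x ⟩
    x · x ⋆       ≤⟨ y≤x+y ⟩
    1# ∪ x · x ⋆  ≤⟨ star-unfoldˡ x ⟩
    x ⋆           ∎

  x≤y⋆⇒x⋆≤y⋆ : ∀ {x y} → x ≤ y ⋆ → x ⋆ ≤ y ⋆
  x≤y⋆⇒x⋆≤y⋆ {x} {y} x≤y⋆ = begin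
    x ⋆        ≤⟨ x≤x·y⋆ (x ⋆) y ⟩
    x ⋆ · y ⋆  ≤⟨ star-indˡ x (y ⋆) x·y⋆≤y⋆ ⟩
    y ⋆        ∎
    where
    x·y⋆≤y⋆ : x · y ⋆ ≤ y ⋆
    x·y⋆≤y⋆ = ≤-trans (*-monoˡ-≤ (y ⋆) x≤y⋆) (x⋆x⋆≤x⋆ y)

  ⋆-mono : ∀ {x y} → x ≤ y → x ⋆ ≤ y ⋆
  ⋆-mono {y = y} x≤y = x≤y⋆⇒x⋆≤y⋆ (≤-trans x≤y (x≤x⋆ y))

  ⋆-cong : ∀ {x y} → x ≈ y → x ⋆ ≈ y ⋆
  ⋆-cong x≈y = ≤-antisym (⋆-mono (≤-reflexive x≈y)) (⋆-mono (≤-reflexive (sym x≈y)))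

  x⋆⋆≈x⋆ : ∀ x → x ⋆ ⋆ ≈ x ⋆
  x⋆⋆≈x⋆ x = ≤-antisym (x≤y⋆⇒x⋆≤y⋆ ≤-refl) (x≤x⋆ (x ⋆))

  [x⋆∪y]⋆≈[x∪y]⋆ : ∀ x y → (x ⋆ ∪ y) ⋆ ≈ (x ∪ y) ⋆
  [x⋆∪y]⋆≈[x∪y]⋆ x y = ≤-antisym
    (x≤y⋆⇒x⋆≤y⋆ (+-least (⋆-mono x≤x+y) (≤-trans y≤x+y (x≤x⋆ (x ∪ y)))))
    (⋆-mono (+-mono-≤ (x≤x⋆ x) ≤-refl))

  [x∪y⋆]⋆≈[x∪y]⋆ : ∀ x y → (x ∪ y ⋆) ⋆ ≈ (x ∪ y) ⋆
  [x∪y⋆]⋆≈[x∪y]⋆ x y = begin-equality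
    (x ∪ y ⋆) ⋆  ≈⟨ ⋆-cong (+-comm x (y ⋆)) ⟩
    (y ⋆ ∪ x) ⋆  ≈⟨ [x⋆∪y]⋆≈[x∪y]⋆ y x ⟩
    (y ∪ x) ⋆    ≈⟨ ⋆-cong (+-comm y x) ⟩
    (x ∪ y) ⋆    ∎

  s≈α⋆⇒s⋆≈s : ∀ {s α} → s ≈ α ⋆ → s ⋆ ≈ s
  s≈α⋆⇒s⋆≈s {s} {α} s≈α⋆ = begin-equality
    s ⋆    ≈⟨ ⋆-cong s≈α⋆ ⟩
    α ⋆ ⋆  ≈⟨ x⋆⋆≈x⋆ α ⟩
    α ⋆    ≈⟨ s≈α⋆ ⟨
    s      ∎

  s≈α⋆⇒1≤s : ∀ {s α} → s ≈ α ⋆ → 1# ≤ s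
  s≈α⋆⇒1≤s s≈α⋆ = ≤-resp-≈ refl (sym s≈α⋆) (1≤x⋆ _)

  s≈α⋆⇒s·s≤s : ∀ {s α} → s ≈ α ⋆ → s · s ≤ s
  s≈α⋆⇒s·s≤s s≈α⋆ =
    ≤-resp-≈ (sym (*-cong s≈α⋆ s≈α⋆)) (sym s≈α⋆) (x⋆x⋆≤x⋆ _)

  x≤s⇒x⋆≤s : ∀ {x s α} → s ≈ α ⋆ → x ≤ s → x ⋆ ≤ s
  x≤s⇒x⋆≤s s≈α⋆ x≤s = ≤-trans (⋆-mono x≤s) (≤-reflexive (s≈α⋆⇒s⋆≈s s≈α⋆))

  x≤s⇒[x∪s]⋆≈s : ∀ {x s α} → s ≈ α ⋆ → x ≤ s → (x ∪ s) ⋆ ≈ s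
  x≤s⇒[x∪s]⋆≈s s≈α⋆ x≤s = trans (⋆-cong x≤s) (s≈α⋆⇒s⋆≈s s≈α⋆)

  [x∪y]⋆≈y⇒x≤y : ∀ {x y} → (x ∪ y) ⋆ ≈ y → x ≤ y
  [x∪y]⋆≈y⇒x≤y {x} {y} [x∪y]⋆≈y = begin
    x            ≤⟨ x≤x+y ⟩
    x ∪ y        ≤⟨ x≤x⋆ (x ∪ y) ⟩
    (x ∪ y) ⋆    ≈⟨ [x∪y]⋆≈y ⟩
    y            ∎

module _ {c ℓ : Level} (K : KleeneAlgebra c ℓ) where

  open KleeneAlgebra K
  open IsIdempotentSemiring isIdempotentSemiring
  open KleeneAlgebraProperties K
  open HKAData (K ⁺) using (_≈ₛ_; _⊔ₛ_; 0ₛ; γ)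
  open Order _≈ₛ_ _⊔ₛ_ using () renaming (_≤_ to _≤ₛ_; Complete to Completeₛ)

  kernel-≤⇒≤ : ∀ {ξ χ : Kernel K} → ξ ≤ₛ χ → proj₁ ξ ≤ proj₁ χ
  kernel-≤⇒≤ = [x∪y]⋆≈y⇒x≤y

  ≤⇒kernel-≤ : ∀ {ξ : Kernel K} (χ : Kernel K) → proj₁ ξ ≤ proj₁ χ → ξ ≤ₛ χ
  ≤⇒kernel-≤ (_ , _ , χ≈α⋆) = x≤s⇒[x∪s]⋆≈s χ≈α⋆

  kernel-⊔-idem : ∀ (ξ : Kernel K) → (ξ ⊔ₛ ξ) ≈ₛ ξ
  kernel-⊔-idem (x , _ , x≈α⋆) = trans (⋆-cong (+-idem x)) (s≈α⋆⇒s⋆≈s x≈α⋆)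

  kernel-⊔-identityˡ : ∀ (ξ : Kernel K) → (0ₛ ⊔ₛ ξ) ≈ₛ ξ
  kernel-⊔-identityˡ (x , _ , x≈α⋆) = begin
    (0# ⋆ ∪ x) ⋆  ≈⟨ [x⋆∪y]⋆≈[x∪y]⋆ 0# x ⟩
    (0# ∪ x) ⋆    ≈⟨ ⋆-cong (+-identityˡ x) ⟩
    x ⋆           ≈⟨ s≈α⋆⇒s⋆≈s x≈α⋆ ⟩
    x             ∎
    where open ≈-Reasoning setoid

  kernel-⊔-identityʳ : ∀ (ξ : Kernel K) → (ξ ⊔ₛ 0ₛ) ≈ₛ ξ
  kernel-⊔-identityʳ ξ@(x , _) =
    trans (⋆-cong (+-comm x (0# ⋆))) (kernel-⊔-identityˡ ξ)

  kernel-⊔-assoc : ∀ (ξ χ ζ : Kernel K) → ((ξ ⊔ₛ χ) ⊔ₛ ζ) ≈ₛ (ξ ⊔ₛ (χ ⊔ₛ ζ))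
  kernel-⊔-assoc (x , _) (y , _) (z , _) = begin
    ((x ∪ y) ⋆ ∪ z) ⋆  ≈⟨ [x⋆∪y]⋆≈[x∪y]⋆ (x ∪ y) z ⟩
    ((x ∪ y) ∪ z) ⋆    ≈⟨ ⋆-cong (+-assoc x y z) ⟩
    (x ∪ (y ∪ z)) ⋆    ≈⟨ [x∪y⋆]⋆≈[x∪y]⋆ x (y ∪ z) ⟨
    (x ∪ (y ∪ z) ⋆) ⋆  ∎
    where open ≈-Reasoning setoid

  kernel-isSemilattice : IsIdempotentCommutativeMonoid _≈ₛ_ _⊔ₛ_ 0ₛ
  kernel-isSemilattice = record
    { isCommutativeMonoid = record
      { isMonoid = record
        { isSemigroup = record
          { isMagma = record
            { isEquivalence = record { refl = refl ; sym = sym ; trans = trans }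
            ; ∙-cong        = λ x≈x′ y≈y′ → ⋆-cong (+-cong x≈x′ y≈y′)
            }
          ; assoc = kernel-⊔-assoc
          }
        ; identity = kernel-⊔-identityˡ , kernel-⊔-identityʳ
        }
      ; comm = λ (x , _) (y , _) → ⋆-cong (+-comm x y)
      }
    ; idem = kernel-⊔-idem
    }

  kernel-complete : ∀ {p} → Complete p → Completeₛ p
  kernel-complete {p} complete P = γ s , upper , least
    where
    image : Pred Carrier (c ⊔ ℓ ⊔ p)
    image x = ∃ λ ξ → P ξ × (x ≈ proj₁ ξ)
    s : Carrier
    s = proj₁ (complete image)
    s-isLub : IsLub image s
    s-isLub = proj₂ (complete image)
    upper : ∀ ξ → P ξ → ξ ≤ₛ (γ s)
    upper ξ Pξ = ≤⇒kernel-≤ {ξ} (γ s)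
      (≤-trans (proj₁ s-isLub (proj₁ ξ) (ξ , Pξ , refl)) (x≤x⋆ s))
    least : ∀ χ → (∀ ξ → P ξ → ξ ≤ₛ χ) → (γ s) ≤ₛ χ
    least χ@(y , _ , y≈α⋆) χ-upper = ≤⇒kernel-≤ {γ s} χ (x≤s⇒x⋆≤s y≈α⋆ s≤y)
      where
      s≤y : s ≤ y
      s≤y = proj₂ s-isLub y λ { x (ξ , Pξ , x≈ξ) →
        ≤-resp-≈ (sym x≈ξ) refl (kernel-≤⇒≤ {ξ} {χ} (χ-upper ξ Pξ)) }

  K⁺-isHKA : IsHKA (K ⁺)
  K⁺-isHKA = record
    { isIdempotentSemiring = isIdempotentSemiring
    ; isSemilatticeₛ       = kernel-isSemilattice
    ; ⊗₁-join      = λ (x , _) α β → distribˡ x α β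
    ; ⊗₁-zero      = λ (x , _) → zeroʳ x
    ; ⊗₁-mono      = λ ξ χ α ξ≤χ → *-monoˡ-≤ α (kernel-≤⇒≤ {ξ} {χ} ξ≤χ)
    ; ⊗₁-unit      = λ (x , _) → *-identityʳ x
    ; ⊗₂-join      = λ α β (x , _) → distribʳ x α β
    ; ⊗₂-zero      = λ (x , _) → zeroˡ x
    ; ⊗₂-mono      = λ α ξ χ ξ≤χ → *-monoʳ-≤ α (kernel-≤⇒≤ {ξ} {χ} ξ≤χ)
    ; ⊗₂-unit      = λ (x , _) → *-identityˡ x
    ; ⊗₁-e         = λ _ _ → refl
    ; ⊗₂-e         = λ _ _ → refl
    ; γ-surjective = λ (_ , α , x≈α⋆) → α , sym x≈α⋆
    ; e-injective  = λ _ _ x≈y → x≈y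
    ; adjunction₁  = λ α ξ γα≤ξ → ≤-trans (x≤x⋆ α) (kernel-≤⇒≤ {γ α} {ξ} γα≤ξ)
    ; adjunction₂  = λ α (x , β , x≈β⋆) α≤x →
                       ≤⇒kernel-≤ {γ α} (x , β , x≈β⋆) (x≤s⇒x⋆≤s x≈β⋆ α≤x)
    ; γ∘e          = λ (_ , _ , x≈α⋆) → s≈α⋆⇒s⋆≈s x≈α⋆
    ; e-refl       = λ (_ , _ , x≈α⋆) → s≈α⋆⇒1≤s x≈α⋆
    ; e-trans      = λ (_ , _ , x≈α⋆) → s≈α⋆⇒s·s≤s x≈α⋆
    ; H6ˡ          = star-indˡ
    ; H6ʳ          = star-indʳ
    }

  K⁺-isContinuousHKA : ∀ p → IsContinuousKA p K → IsContinuousHKA p (K ⁺)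
  K⁺-isContinuousHKA p continuous = record
    { isHKA     = K⁺-isHKA
    ; completeₐ = complete
    ; ·-joinsˡ  = ·-joinsˡ
    ; ·-joinsʳ  = ·-joinsʳ
    ; completeₛ = kernel-complete {p} complete
    ; H7        = star-lub
    }
    where open IsContinuousKA continuous

proposition3p9 : {c ℓ : Level} (p : Level) (K : KleeneAlgebra c ℓ) →
                 IsHKA (K ⁺) × (IsContinuousKA p K → IsContinuousHKA p (K ⁺))
proposition3p9 p K = K⁺-isHKA K , K⁺-isContinuousHKA K p
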